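{- Let $t\geq 1$ and let $H_t$ be the graph with vertices $x',y',x_0,\dots,x_t,y_0,\dots,y_t$ and edges $x'y',x'x_0,x'y_0,y'x_0,y'y_0$, $x_{i-1}x_i$ and $y_{i-1}y_i$ for $1\le i\le t$, and $x_iy_i$ for $1\le i\le t-1$. If $\varphi$ is a conflict-free incidence coloring of $H_t$ using at most $6$ colors, then $\{\varphi(x_{t-1},x_{t-1}x_t),\varphi(x_t,x_{t-1}x_t)\}=\{\varphi(y_{t-1},y_{t-1}y_t),\varphi(y_t,y_{t-1}y_t)\}$.
   Context: An incidence of a graph is a pair $(a,e)$ with $a$ an endpoint of the edge $e$; for a vertex $c$, $I(c)$ is the set of incidences $(b,e)$ with $e$ incident with $c$; two incidences conflict if both lie in some $I(c)$; a conflict-free incidence coloring assigns colors to incidences so that conflicting incidences get distinct colors. -}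

module Defs where

open import Data.Nat using (ℕ; suc; _≤_; _<_)
open import Data.Fin using (Fin; toℕ; inject₁; fromℕ)
open import Data.Product using (Σ; _×_; _,_)
open import Data.Sum using (_⊎_; inj₁; inj₂)
open import Relation.Binary.PropositionalEquality using (_≡_; _≢_)
open import Function.Bundles using (_⇔_)

data V (t : ℕ) : Set where
  x′ y′ : V t
  X Y   : Fin (suc t) → V t

-- Edges of H_t, each listed once (one orientation)
data E (t : ℕ) : V t → V t → Set where
  e-x′y′ : E t x′ y′
  e-x′x₀ : E t x′ (X Data.Fin.zero)
  e-x′y₀ : E t x′ (Y Data.Fin.zero)
  e-y′x₀ : E t y′ (X Data.Fin.zero)
  e-y′y₀ : E t y′ (Y Data.Fin.zero)
  -- x_{i-1} x_i and y_{i-1} y_i for 1 ≤ i ≤ t  (here indexed by i-1 : Fin t)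
  e-xx   : (i : Fin t) → E t (X (inject₁ i)) (X (Data.Fin.suc i))
  e-yy   : (i : Fin t) → E t (Y (inject₁ i)) (Y (Data.Fin.suc i))
  e-xy   : (i : Fin (suc t)) → 1 ≤ toℕ i → toℕ i < t → E t (X i) (Y i)

Adj : (t : ℕ) → V t → V t → Set
Adj t a b = E t a b ⊎ E t b a

-- An incidence (a, e) with e = ab is represented by (a , b , proof that ab is an edge)
Inc : ℕ → Set
Inc t = Σ (V t) λ a → Σ (V t) λ b → Adj t a b

InI : (t : ℕ) → V t → Inc t → Set
InI t c (a , b , _) = (c ≡ a) ⊎ (c ≡ b)

Conflict : (t : ℕ) → Inc t → Inc t → Set
Conflict t p q = p ≢ q × Σ (V t) λ c → InI t c p × InI t c q

ConflictFree : (t : ℕ) {C : Set} → (Inc t → C) → Set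
ConflictFree t φ = ∀ p q → Conflict t p q → φ p ≢ φ q

PairEq : {A : Set} → A → A → A → A → Set
PairEq a b c d = ∀ z → ((z ≡ a) ⊎ (z ≡ b)) ⇔ ((z ≡ c) ⊎ (z ≡ d))

-- the incidences (x_{t-1}, x_{t-1}x_t), (x_t, x_{t-1}x_t), etc., for t = suc s
incXlo incXhi incYlo incYhi : (s : ℕ) → Inc (suc s)
incXlo s = X (inject₁ (fromℕ s)) , X (Data.Fin.suc (fromℕ s)) , inj₁ (e-xx (fromℕ s))
incXhi s = X (Data.Fin.suc (fromℕ s)) , X (inject₁ (fromℕ s)) , inj₂ (e-xx (fromℕ s))
incYlo s = Y (inject₁ (fromℕ s)) , Y (Data.Fin.suc (fromℕ s)) , inj₁ (e-yy (fromℕ s))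
incYhi s = Y (Data.Fin.suc (fromℕ s)) , Y (inject₁ (fromℕ s)) , inj₂ (e-yy (fromℕ s))

-- In a conflict-free colouring, the six incidences at a vertex of degree 3
-- pairwise conflict, so with six colours they use every colour exactly once:
-- the colour pairs of the three edges at such a vertex partition the colours.
-- At x′, y′, x₀, y₀ these four partitions force x₀x₁ and y₀y₁ to receive the
-- same pair. Inductively, if x_{i-1}x_i and y_{i-1}y_i carry the same pair,
-- then at x_i and y_i the edges x_ix_{i+1} and y_iy_{i+1} both receive the
-- complement of that pair and of the pair of the common edge x_iy_i.
module Submission where

open import Level using (Level; _⊔_)
open import Data.Empty using (⊥-elim)
open import Data.Fin using (Fin; zero; suc; inject₁; fromℕ; punchOut; _<_)
open import Data.Fin.Induction using (<-weakInduction)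
open import Data.Fin.Properties
  using (_≟_; any?; pigeonhole; punchOut-injective; <⇒≢; <-trans; ≤-refl; ≤̄⇒inject₁<; inject₁ℕ<)
open import Data.Nat using (ℕ; suc; s≤s; z≤n)
open import Data.Nat.Properties using (n<1+n)
open import Data.Product using (∃; ∃₂; _×_; _,_; proj₁; proj₂)
open import Data.Sum using (_⊎_; inj₁; inj₂; swap) renaming (map to ⊎-map)
open import Data.Vec using (Vec; []; _∷_; lookup)
open import Data.Vec.Membership.Propositional using (_∈_)
open import Data.Vec.Membership.Propositional.Properties using (∈-lookup)
open import Data.Vec.Relation.Unary.All using ([]; _∷_)
open import Data.Vec.Relation.Unary.AllPairs using ([]; _∷_)
open import Data.Vec.Relation.Unary.Any using (here; there)
open import Data.Vec.Relation.Unary.Unique.Propositional using (Unique)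
open import Data.Vec.Relation.Unary.Unique.Propositional.Properties using (lookup-injective)
open import Function using (_∘_; id)
open import Function.Bundles using (mk⇔)
open import Function.Definitions using (Injective)
open import Relation.Binary.PropositionalEquality using (_≡_; _≢_; refl; sym)
open import Relation.Nullary using (¬_; yes; no)
open import Relation.Unary using (Pred; Universal; _⊆_; _≐_; _∪_; _⊥_)

open import Defs

private
  variable
    a ℓ : Level
    A : Set a
    P Q R P′ Q′ R′ M W X′ Y′ : Pred A ℓ

Pair : A → A → Pred A _
Pair x y z = z ≡ x ⊎ z ≡ y

Pair-⊥ : {x y u v : A} → x ≢ u → x ≢ v → y ≢ u → y ≢ v → Pair x y ⊥ Pair u v
Pair-⊥ x≢u _   _   _   (inj₁ refl , inj₁ x≡u) = x≢u x≡u
Pair-⊥ _   x≢v _   _   (inj₁ refl , inj₂ x≡v) = x≢v x≡v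
Pair-⊥ _   _   y≢u _   (inj₂ refl , inj₁ y≡u) = y≢u y≡u
Pair-⊥ _   _   _   y≢v (inj₂ refl , inj₂ y≡v) = y≢v y≡v

⊥⇒≢ : P ⊥ Q → {x y : A} → P x → Q y → x ≢ y
⊥⇒≢ P⊥Q x∈P y∈Q refl = P⊥Q (x∈P , y∈Q)

record Partition₃ {A : Set a} (P Q R : Pred A ℓ) : Set (a ⊔ ℓ) where
  field
    cover : Universal (P ∪ Q ∪ R)
    P⊥Q   : P ⊥ Q
    P⊥R   : P ⊥ R
    Q⊥R   : Q ⊥ R

open Partition₃

Partition₃-swap₂₃ : Partition₃ P Q R → Partition₃ P R Q
Partition₃-swap₂₃ π = record
  { cover = ⊎-map id swap ∘ cover π
  ; P⊥Q   = P⊥R π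
  ; P⊥R   = P⊥Q π
  ; Q⊥R   = λ { (r , q) → Q⊥R π (q , r) }
  }

Partition₃-resp-≐ : P ≐ P′ → Q ≐ Q′ → R ≐ R′ → Partition₃ P Q R → Partition₃ P′ Q′ R′
Partition₃-resp-≐ (P⊆P′ , P′⊆P) (Q⊆Q′ , Q′⊆Q) (R⊆R′ , R′⊆R) π = record
  { cover = ⊎-map P⊆P′ (⊎-map Q⊆Q′ R⊆R′) ∘ cover π
  ; P⊥Q   = λ { (p , q) → P⊥Q π (P′⊆P p , Q′⊆Q q) }
  ; P⊥R   = λ { (p , r) → P⊥R π (P′⊆P p , R′⊆R r) }
  ; Q⊥R   = λ { (q , r) → Q⊥R π (Q′⊆Q q , R′⊆R r) }
  }

complement-⊆ : Partition₃ P Q R → Partition₃ P′ Q′ R → P′ ⊆ P → Q ⊆ Q′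
complement-⊆ π π′ P′⊆P {z} z∈Q with cover π′ z
... | inj₁ z∈P′        = ⊥-elim (P⊥Q π (P′⊆P z∈P′ , z∈Q))
... | inj₂ (inj₁ z∈Q′) = z∈Q′
... | inj₂ (inj₂ z∈R)  = ⊥-elim (Q⊥R π (z∈Q , z∈R))

complement-≐ : Partition₃ P Q R → Partition₃ P′ Q′ R → P ≐ P′ → Q ≐ Q′
complement-≐ π π′ (P⊆P′ , P′⊆P) = complement-⊆ π π′ P′⊆P , complement-⊆ π′ π P⊆P′

-- The partitions at x′, y′, x₀ and y₀ in H_t, where M is the colour pair of x′y′.
square-⊆ : Partition₃ M P Q → Partition₃ M R W → Partition₃ P R X′ → Partition₃ Q W Y′ →
           X′ ⊆ Y′
square-⊆ πM πM′ πX πY {z} z∈X with cover πY z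
... | inj₂ (inj₂ z∈Y) = z∈Y
... | inj₁ z∈Q with cover πM′ z
...   | inj₁ z∈M        = ⊥-elim (P⊥R πM (z∈M , z∈Q))
...   | inj₂ (inj₁ z∈R) = ⊥-elim (Q⊥R πX (z∈R , z∈X))
...   | inj₂ (inj₂ z∈W) = ⊥-elim (P⊥Q πY (z∈Q , z∈W))
square-⊆ πM πM′ πX πY {z} z∈X | inj₂ (inj₁ z∈W) with cover πM z
...   | inj₁ z∈M        = ⊥-elim (P⊥R πM′ (z∈M , z∈W))
...   | inj₂ (inj₁ z∈P) = ⊥-elim (P⊥R πX (z∈P , z∈X))
...   | inj₂ (inj₂ z∈Q) = ⊥-elim (P⊥Q πY (z∈Q , z∈W))

square-≐ : Partition₃ M P Q → Partition₃ M R W → Partition₃ P R X′ → Partition₃ Q W Y′ →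
           X′ ≐ Y′
square-≐ πM πM′ πX πY =
  square-⊆ πM πM′ πX πY , square-⊆ (Partition₃-swap₂₃ πM) (Partition₃-swap₂₃ πM′) πY πX

injective⇒surjective : ∀ {n} (f : Fin n → Fin n) → Injective _≡_ _≡_ f → ∀ y → ∃ λ i → f i ≡ y
injective⇒surjective {suc n} f f-inj y with any? (λ i → f i ≟ y)
... | yes hit = hit
... | no miss = ⊥-elim (collision (pigeonhole (n<1+n n) (punchOut ∘ y≢f)))
  where
  y≢f : ∀ i → y ≢ f i
  y≢f i y≡fi = miss (i , sym y≡fi)
  collision : ¬ ∃₂ λ i j → i < j × punchOut (y≢f i) ≡ punchOut (y≢f j)
  collision (i , j , i<j , same) = <⇒≢ i<j (f-inj (punchOut-injective (y≢f i) (y≢f j) same))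

unique⇒complete : ∀ {n} {xs : Vec (Fin n) n} → Unique xs → ∀ y → y ∈ xs
unique⇒complete {xs = xs} u y with injective⇒surjective (lookup xs) (lookup-injective u _ _) y
... | i , refl = ∈-lookup i xs

disjoint-pairs-unique : {x₁ y₁ x₂ y₂ x₃ y₃ : A} → x₁ ≢ y₁ → x₂ ≢ y₂ → x₃ ≢ y₃ →
  Pair x₁ y₁ ⊥ Pair x₂ y₂ → Pair x₁ y₁ ⊥ Pair x₃ y₃ → Pair x₂ y₂ ⊥ Pair x₃ y₃ →
  Unique (x₁ ∷ y₁ ∷ x₂ ∷ y₂ ∷ x₃ ∷ y₃ ∷ [])
disjoint-pairs-unique x₁≢y₁ x₂≢y₂ x₃≢y₃ ⊥₁₂ ⊥₁₃ ⊥₂₃ =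
    (x₁≢y₁ ∷ ⊥⇒≢ ⊥₁₂ l l ∷ ⊥⇒≢ ⊥₁₂ l r ∷ ⊥⇒≢ ⊥₁₃ l l ∷ ⊥⇒≢ ⊥₁₃ l r ∷ [])
  ∷ (⊥⇒≢ ⊥₁₂ r l ∷ ⊥⇒≢ ⊥₁₂ r r ∷ ⊥⇒≢ ⊥₁₃ r l ∷ ⊥⇒≢ ⊥₁₃ r r ∷ [])
  ∷ (x₂≢y₂ ∷ ⊥⇒≢ ⊥₂₃ l l ∷ ⊥⇒≢ ⊥₂₃ l r ∷ [])
  ∷ (⊥⇒≢ ⊥₂₃ r l ∷ ⊥⇒≢ ⊥₂₃ r r ∷ [])
  ∷ (x₃≢y₃ ∷ [])
  ∷ []
  ∷ []
  where
  l : {x y : A} → Pair x y x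
  l = inj₁ refl
  r : {x y : A} → Pair x y y
  r = inj₂ refl

disjoint-pairs-partition : {x₁ y₁ x₂ y₂ x₃ y₃ : Fin 6} → x₁ ≢ y₁ → x₂ ≢ y₂ → x₃ ≢ y₃ →
  Pair x₁ y₁ ⊥ Pair x₂ y₂ → Pair x₁ y₁ ⊥ Pair x₃ y₃ → Pair x₂ y₂ ⊥ Pair x₃ y₃ →
  Partition₃ (Pair x₁ y₁) (Pair x₂ y₂) (Pair x₃ y₃)
disjoint-pairs-partition x₁≢y₁ x₂≢y₂ x₃≢y₃ ⊥₁₂ ⊥₁₃ ⊥₂₃ =
  record { cover = cover′ ; P⊥Q = ⊥₁₂ ; P⊥R = ⊥₁₃ ; Q⊥R = ⊥₂₃ }
  where
  cover′ : Universal _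
  cover′ z with unique⇒complete (disjoint-pairs-unique x₁≢y₁ x₂≢y₂ x₃≢y₃ ⊥₁₂ ⊥₁₃ ⊥₂₃) z
  ... | here z≡x₁                                 = inj₁ (inj₁ z≡x₁)
  ... | there (here z≡y₁)                         = inj₁ (inj₂ z≡y₁)
  ... | there (there (here z≡x₂))                 = inj₂ (inj₁ (inj₁ z≡x₂))
  ... | there (there (there (here z≡y₂)))         = inj₂ (inj₁ (inj₂ z≡y₂))
  ... | there (there (there (there (here z≡x₃)))) = inj₂ (inj₂ (inj₁ z≡x₃))
  ... | there (there (there (there (there (here z≡y₃))))) = inj₂ (inj₂ (inj₂ z≡y₃))

head≢⇒≢ : ∀ {t} {p q : Inc t} → proj₁ p ≢ proj₁ q → p ≢ q
head≢⇒≢ h refl = h refl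

tail≢⇒≢ : ∀ {t} {p q : Inc t} → proj₁ (proj₂ p) ≢ proj₁ (proj₂ q) → p ≢ q
tail≢⇒≢ h refl = h refl

module _ {t : ℕ} {C : Set} (φ : Inc t → C) where

  edgeColours : {u v : V t} → E t u v → Pred C _
  edgeColours {u} {v} e = Pair (φ (u , v , inj₁ e)) (φ (v , u , inj₂ e))

  -- Defined through the underlying edge, so that both endpoints see the same set.
  colours : {u v : V t} → Adj t u v → Pred C _
  colours (inj₁ e) = edgeColours e
  colours (inj₂ e) = edgeColours e

  Pair≐colours : {u v : V t} (α : Adj t u v) → Pair (φ (u , v , α)) (φ (v , u , swap α)) ≐ colours α
  Pair≐colours (inj₁ e) = id , id
  Pair≐colours (inj₂ e) = swap , swap

module _ {t : ℕ} {C : Set} (φ : Inc t → C) (φ-cf : ConflictFree t φ) where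

  colour≢-in-I : {c : V t} {p q : Inc t} → InI t c p → InI t c q → p ≢ q → φ p ≢ φ q
  colour≢-in-I {c} p∈I q∈I p≢q = φ-cf _ _ (p≢q , c , p∈I , q∈I)

  reverse-colour≢ : {c n : V t} (α : Adj t c n) → c ≢ n → φ (c , n , α) ≢ φ (n , c , swap α)
  reverse-colour≢ α c≢n = colour≢-in-I (inj₁ refl) (inj₂ refl) (head≢⇒≢ c≢n)

  adjacent-Pairs-⊥ : {c n m : V t} (α : Adj t c n) (β : Adj t c m) → c ≢ n → c ≢ m → n ≢ m →
    Pair (φ (c , n , α)) (φ (n , c , swap α)) ⊥ Pair (φ (c , m , β)) (φ (m , c , swap β))
  adjacent-Pairs-⊥ α β c≢n c≢m n≢m = Pair-⊥
    (colour≢-in-I (inj₁ refl) (inj₁ refl) (tail≢⇒≢ n≢m))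
    (colour≢-in-I (inj₁ refl) (inj₂ refl) (head≢⇒≢ c≢m))
    (colour≢-in-I (inj₂ refl) (inj₁ refl) (head≢⇒≢ (c≢n ∘ sym)))
    (colour≢-in-I (inj₂ refl) (inj₂ refl) (head≢⇒≢ n≢m))

degree3-partition : ∀ {t} (φ : Inc t → Fin 6) → ConflictFree t φ →
  {c n₁ n₂ n₃ : V t} (α₁ : Adj t c n₁) (α₂ : Adj t c n₂) (α₃ : Adj t c n₃) →
  c ≢ n₁ → c ≢ n₂ → c ≢ n₃ → n₁ ≢ n₂ → n₁ ≢ n₃ → n₂ ≢ n₃ →
  Partition₃ (colours φ α₁) (colours φ α₂) (colours φ α₃)
degree3-partition φ φ-cf α₁ α₂ α₃ c≢n₁ c≢n₂ c≢n₃ n₁≢n₂ n₁≢n₃ n₂≢n₃ =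
  Partition₃-resp-≐ (Pair≐colours φ α₁) (Pair≐colours φ α₂) (Pair≐colours φ α₃)
    (disjoint-pairs-partition
      (reverse-colour≢ φ φ-cf α₁ c≢n₁)
      (reverse-colour≢ φ φ-cf α₂ c≢n₂)
      (reverse-colour≢ φ φ-cf α₃ c≢n₃)
      (adjacent-Pairs-⊥ φ φ-cf α₁ α₂ c≢n₁ c≢n₂ n₁≢n₂)
      (adjacent-Pairs-⊥ φ φ-cf α₁ α₃ c≢n₁ c≢n₃ n₁≢n₃)
      (adjacent-Pairs-⊥ φ φ-cf α₂ α₃ c≢n₂ c≢n₃ n₂≢n₃))

module _ {s : ℕ} (φ : Inc (suc s) → Fin 6) (φ-cf : ConflictFree (suc s) φ) where

  SameColours : Fin (suc s) → Set
  SameColours i = edgeColours φ (e-xx i) ≐ edgeColours φ (e-yy i)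

  first-SameColours : SameColours zero
  first-SameColours = square-≐
    (degree3-partition φ φ-cf (inj₁ e-x′y′) (inj₁ e-x′x₀) (inj₁ e-x′y₀)
      (λ ()) (λ ()) (λ ()) (λ ()) (λ ()) (λ ()))
    (degree3-partition φ φ-cf (inj₂ e-x′y′) (inj₁ e-y′x₀) (inj₁ e-y′y₀)
      (λ ()) (λ ()) (λ ()) (λ ()) (λ ()) (λ ()))
    (degree3-partition φ φ-cf (inj₂ e-x′x₀) (inj₂ e-y′x₀) (inj₁ (e-xx zero))
      (λ ()) (λ ()) (λ ()) (λ ()) (λ ()) (λ ()))
    (degree3-partition φ φ-cf (inj₂ e-x′y₀) (inj₂ e-y′y₀) (inj₁ (e-yy zero))
      (λ ()) (λ ()) (λ ()) (λ ()) (λ ()) (λ ()))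

  next-SameColours : (j : Fin s) → SameColours (inject₁ j) → SameColours (suc j)
  next-SameColours j = complement-≐
    (degree3-partition φ φ-cf (inj₂ (e-xx (inject₁ j))) (inj₁ (e-xx (suc j))) (inj₁ rung)
      (k≢k₋ ∘ X-injective) (k≢k₊ ∘ X-injective) (λ ()) (k₋≢k₊ ∘ X-injective) (λ ()) (λ ()))
    (degree3-partition φ φ-cf (inj₂ (e-yy (inject₁ j))) (inj₁ (e-yy (suc j))) (inj₂ rung)
      (k≢k₋ ∘ Y-injective) (k≢k₊ ∘ Y-injective) (λ ()) (k₋≢k₊ ∘ Y-injective) (λ ()) (λ ()))
    where
    rung : E (suc s) (X (suc (inject₁ j))) (Y (suc (inject₁ j)))
    rung = e-xy (suc (inject₁ j)) (s≤s z≤n) (s≤s (inject₁ℕ< j))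

    k₋<k : inject₁ (inject₁ j) < suc (inject₁ j)
    k₋<k = ≤̄⇒inject₁< ≤-refl

    k<k₊ : suc (inject₁ j) < suc (suc j)
    k<k₊ = s≤s (≤̄⇒inject₁< ≤-refl)

    k≢k₋ : suc (inject₁ j) ≢ inject₁ (inject₁ j)
    k≢k₋ = <⇒≢ k₋<k ∘ sym

    k≢k₊ : suc (inject₁ j) ≢ suc (suc j)
    k≢k₊ = <⇒≢ k<k₊

    k₋≢k₊ : inject₁ (inject₁ j) ≢ suc (suc j)
    k₋≢k₊ = <⇒≢ (<-trans k₋<k k<k₊)

    X-injective : {i i′ : Fin (suc (suc s))} → X {suc s} i ≡ X i′ → i ≡ i′
    X-injective refl = refl

    Y-injective : {i i′ : Fin (suc (suc s))} → Y {suc s} i ≡ Y i′ → i ≡ i′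
    Y-injective refl = refl

lemma3p7 : (s : ℕ) (φ : Inc (suc s) → Fin 6) → ConflictFree (suc s) φ →
    PairEq (φ (incXlo s)) (φ (incXhi s)) (φ (incYlo s)) (φ (incYhi s))
lemma3p7 s φ φ-cf z = mk⇔ (proj₁ last) (proj₂ last)
  where
  last : SameColours φ φ-cf (fromℕ s)
  last = <-weakInduction (SameColours φ φ-cf)
           (first-SameColours φ φ-cf) (next-SameColours φ φ-cf) (fromℕ s)
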